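{- Let $c_n$ be the number of $FU_k$-equivalence classes of the set $\mathcal{L}_n$ of Łukasiewicz paths of length $n$. Then $\sum_{n\geq0}c_nx^n=\frac{2}{1-x+\sqrt{1-2x+x^2-4x^3}}$, which is also the generating function of the numbers of $U_kF$-equivalence classes of $\mathcal{L}_n$.
   Context: A Łukasiewicz path of length $n$ is a sequence of $n$ steps from $\{(1,i): i\geq -1\}$ starting at $(0,0)$, ending at $(n,0)$ and never going below the $x$-axis. Write $D=(1,-1)$, $F=(1,0)$, $U_k=(1,k)$ for $k\geq1$. Steps are numbered $1,\dots,n$; an occurrence of a two-step pattern is at position $i$ if its first step is the $i$-th step. Two Łukasiewicz paths of the same length are $FU_k$-equivalent (resp. $U_kF$-equivalent) if for every $k\geq1$ the set of occurrence positions of $FU_k$ (resp. $U_kF$) is the same in both. -}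

module Defs where

open import Data.Nat using (ℕ; zero; suc; _+_; _*_; _∸_; NonZero)
open import Data.List using (List; []; _∷_; length; map; upTo)
open import Data.Nat.ListAction using (sum)
open import Data.List.Relation.Unary.All using (All)
open import Data.List.Relation.Unary.Any using (Any)
open import Data.List.Relation.Unary.AllPairs using (AllPairs)
open import Data.Maybe using (Maybe; just; nothing)
open import Data.Product using (Σ; _×_)
open import Data.Empty using (⊥)
open import Function.Bundles using (_⇔_)
open import Relation.Nullary using (¬_)
open import Relation.Binary.PropositionalEquality using (_≡_)

-- Steps of a Łukasiewicz path: D = (1,-1), F = (1,0), U k = (1,k) with k ≥ 1.
data Step : Set where
  D : Step
  F : Step
  U : (k : ℕ) → .{{NonZero k}} → Step

Path : Set
Path = List Step

ValidFrom : ℕ → Path → Set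
ValidFrom h [] = h ≡ 0
ValidFrom zero (D ∷ s) = ⊥
ValidFrom (suc h) (D ∷ s) = ValidFrom h s
ValidFrom h (F ∷ s) = ValidFrom h s
ValidFrom h (U k ∷ s) = ValidFrom (h + k) s

Luk : ℕ → Path → Set
Luk n p = (length p ≡ n) × ValidFrom 0 p

-- stepAt p i : the i-th step of p (steps numbered 1,…,length p)
stepAt : Path → ℕ → Maybe Step
stepAt [] _ = nothing
stepAt (x ∷ xs) zero = nothing
stepAt (x ∷ xs) (suc zero) = just x
stepAt (x ∷ xs) (suc (suc i)) = stepAt xs (suc i)

OccFU : (k : ℕ) → .{{NonZero k}} → Path → ℕ → Set
OccFU k p i = (stepAt p i ≡ just F) × (stepAt p (suc i) ≡ just (U k))

OccUF : (k : ℕ) → .{{NonZero k}} → Path → ℕ → Set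
OccUF k p i = (stepAt p i ≡ just (U k)) × (stepAt p (suc i) ≡ just F)

FU-equiv : Path → Path → Set
FU-equiv p q = (k : ℕ) → .{{_ : NonZero k}} → (i : ℕ) → OccFU k p i ⇔ OccFU k q i

UF-equiv : Path → Path → Set
UF-equiv p q = (k : ℕ) → .{{_ : NonZero k}} → (i : ℕ) → OccUF k p i ⇔ OccUF k q i

-- NumClasses _~_ n m : the relation _~_ restricted to Łukasiewicz paths of
-- length n has exactly m equivalence classes, witnessed by a list of m
-- pairwise inequivalent representatives covering all such paths.
NumClasses : (Path → Path → Set) → ℕ → ℕ → Set
NumClasses _~_ n m =
  Σ (List Path) λ R →
    (length R ≡ m) × All (Luk n) R × AllPairs (λ p q → ¬ (p ~ q)) R ×
    ((p : Path) → Luk n p → Any (λ r → p ~ r) R)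

conv : (ℕ → ℕ) → ℕ → ℕ
conv c n = sum (map (λ i → c i * c (n ∸ i)) (upTo (suc n)))

-- The power series C(x) = Σ c_n x^n equals 2/(1-x+sqrt(1-2x+x^2-4x^3)),
-- expressed as the (uniquely solvable) coefficientwise identity
-- C = 1 + x C + x^3 C^2.
HasGF : (ℕ → ℕ) → Set
HasGF c = (c 0 ≡ 1) × (c 1 ≡ c 0) × (c 2 ≡ c 1) ×
  ((n : ℕ) → c (3 + n) ≡ c (2 + n) + conv c n)

-- Recording where the occurrences of a two-step pattern (F U_k, or U_k F) start turns a path into
-- a word over the letters mark k (the two steps of an occurrence) and plain (any other step); two
-- paths of the same length are equivalent exactly when their words agree.  A word comes from a
-- Łukasiewicz path iff its lowest realization (D whenever the height is positive, F at height 0,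
-- the pattern itself for each mark) returns to height 0.  Such a word is empty, plain followed by
-- such a word, or mark k followed by w, a plain step and y: that plain step is the first return to
-- height 0 of the lowest walk from height k, the words w and y are again realizable, and k is one
-- more than the number of F steps forced in w.  So for both patterns the classes are counted by
-- the same c, with C = 1 + x C + x³ C².

module Submission where

open import Defs
open import Algebra.Properties.CommutativeSemigroup using (xy∙z≈xz∙y)
open import Data.Empty using (⊥; ⊥-elim)
open import Data.List using (List; []; _∷_; _++_; length; map; upTo; concat; concatMap; cartesianProduct)
open import Data.List.Properties
  using (length-++; length-map; map-cong; map-cong-local; ∷-injectiveˡ; ∷-injectiveʳ)
open import Data.List.Membership.Propositional using (_∈_; find; lose)
open import Data.List.Membership.Propositional.Properties
  using (∈-map⁺; ∈-map⁻; ∈-++⁺ˡ; ∈-++⁺ʳ; ∈-++⁻; ∈-concatMap⁺; ∈-concatMap⁻; ∈-upTo⁺; ∈-upTo⁻;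
         ∈-cartesianProduct⁺; ∈-cartesianProduct⁻)
open import Data.List.Relation.Binary.Disjoint.Propositional using (Disjoint)
open import Data.List.Relation.Unary.All as All using (All; []; _∷_)
import Data.List.Relation.Unary.All.Properties as All
open import Data.List.Relation.Unary.AllPairs as AllPairs using (AllPairs; []; _∷_)
import Data.List.Relation.Unary.AllPairs.Properties as AllPairs
open import Data.List.Relation.Unary.Any as Any using (Any; here)
import Data.List.Relation.Unary.Any.Properties as Any
open import Data.List.Relation.Unary.Unique.Propositional using (Unique)
import Data.List.Relation.Unary.Unique.Propositional.Properties as Unique
open import Data.Maybe using (just)
open import Data.Maybe.Properties using (just-injective)
open import Data.Nat using (ℕ; zero; suc; _+_; _*_; _∸_; _≤_; _<_; z≤n; s≤s; s≤s⁻¹; NonZero; ≢-nonZero⁻¹)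
open import Data.Nat.ListAction using (sum)
open import Data.Nat.Properties
open import Data.Product using (Σ; _×_; _,_; proj₁; proj₂; map₁; uncurry)
open import Data.Sum using (inj₁; inj₂)
open import Data.Unit using (⊤; tt)
open import Function using (_∘_)
open import Function.Bundles using (_⇔_; mk⇔; Equivalence)
open import Function.Properties.Equivalence using () renaming (refl to ⇔-refl; trans to ⇔-trans)
open import Relation.Binary.PropositionalEquality
open import Relation.Nullary using (¬_; contradiction)

+-right-comm : ∀ h d k → h + d + k ≡ h + k + d
+-right-comm = xy∙z≈xz∙y +-commutativeSemigroup

m+1+n≡1 : ∀ m n → m + suc n ≡ 1 → m ≡ 0 × n ≡ 0
m+1+n≡1 zero    zero refl = refl , refl
m+1+n≡1 (suc m) n    eq   = contradiction (suc-injective eq) (m+1+n≢0 m)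

length-concatMap : ∀ {A B : Set} (f : A → List B) xs →
  length (concatMap f xs) ≡ sum (map (length ∘ f) xs)
length-concatMap f []       = refl
length-concatMap f (x ∷ xs) = trans (length-++ (f x)) (cong (length (f x) +_) (length-concatMap f xs))

length-cartesianProduct : ∀ {A B : Set} (xs : List A) (ys : List B) →
  length (cartesianProduct xs ys) ≡ length xs * length ys
length-cartesianProduct []       ys = refl
length-cartesianProduct (x ∷ xs) ys =
  trans (length-++ (map (x ,_) ys)) (cong₂ _+_ (length-map (x ,_) ys) (length-cartesianProduct xs ys))

Unique-concatMap⁺ : ∀ {A B : Set} {f : A → List B} {xs} (label : B → A) →
  (∀ {x b} → b ∈ f x → label b ≡ x) → (∀ x → Unique (f x)) → Unique xs → Unique (concatMap f xs)
Unique-concatMap⁺ {f = f} {xs} label labelled unique xs-unique =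
  Unique.concat⁺ (All.map⁺ (All.universal unique xs)) (AllPairs.map⁺ (AllPairs.map disjoint xs-unique))
  where
  disjoint : ∀ {x y} → x ≢ y → Disjoint (f x) (f y)
  disjoint x≢y (b∈fx , b∈fy) = x≢y (trans (sym (labelled b∈fx)) (labelled b∈fy))

unique-map⁺ : ∀ {A B : Set} {P : A → Set} {S : B → B → Set} {f : A → B} {xs} →
  (∀ {x y} → P x → P y → S (f x) (f y) → x ≡ y) → All P xs → Unique xs →
  AllPairs (λ u v → ¬ S u v) (map f xs)
unique-map⁺ inj []         []           = []
unique-map⁺ inj (px ∷ pxs) (x∉xs ∷ uxs) =
  All.map⁺ (All.zipWith (λ (x≢y , py) s → x≢y (inj px py s)) (x∉xs , pxs)) ∷ unique-map⁺ inj pxs uxs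

-- Lowest walks of marked words

data Letter : Set where
  plain : Letter
  mark  : (k : ℕ) → .{{NonZero k}} → Letter

Word : Set
Word = List Letter

mark-cong : ∀ {k j} .{{_ : NonZero k}} .{{_ : NonZero j}} → k ≡ j → mark k ≡ mark j
mark-cong refl = refl

mark-injective : ∀ {k j} .{{_ : NonZero k}} .{{_ : NonZero j}} → mark k ≡ mark j → k ≡ j
mark-injective refl = refl

weight : Word → ℕ
weight []           = 0
weight (plain ∷ t)  = 1 + weight t
weight (mark k ∷ t) = 2 + weight t

-- lowest h t is the final height of the lowest realization of t from height h; flats h t counts
-- the F steps it is forced to take at height 0.
lowest : ℕ → Word → ℕ
lowest h       []           = h
lowest h       (mark k ∷ t) = lowest (h + k) t
lowest zero    (plain ∷ t)  = lowest zero t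
lowest (suc h) (plain ∷ t)  = lowest h t

flats : ℕ → Word → ℕ
flats h       []           = 0
flats h       (mark k ∷ t) = flats (h + k) t
flats zero    (plain ∷ t)  = suc (flats zero t)
flats (suc h) (plain ∷ t)  = flats h t

Positive : ℕ → Word → Set
Positive zero    _            = ⊥
Positive (suc h) []           = ⊤
Positive (suc h) (plain ∷ t)  = Positive h t
Positive (suc h) (mark k ∷ t) = Positive (suc h + k) t

weight-++ : ∀ s t → weight (s ++ t) ≡ weight s + weight t
weight-++ []           t = refl
weight-++ (plain ∷ s)  t = cong suc (weight-++ s t)
weight-++ (mark k ∷ s) t = cong (2 +_) (weight-++ s t)

lowest-++ : ∀ h s t → lowest h (s ++ t) ≡ lowest (lowest h s) t
lowest-++ h       []           t = refl
lowest-++ h       (mark k ∷ s) t = lowest-++ (h + k) s t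
lowest-++ zero    (plain ∷ s)  t = lowest-++ zero s t
lowest-++ (suc h) (plain ∷ s)  t = lowest-++ h s t

lowest-+ : ∀ h d t → lowest (h + d) t ≡ lowest h t + (d ∸ flats h t)
lowest-+ h       d       []           = refl
lowest-+ h       d       (mark k ∷ t) =
  trans (cong (λ h′ → lowest h′ t) (+-right-comm h d k)) (lowest-+ (h + k) d t)
lowest-+ zero    zero    (plain ∷ t)  = sym (+-identityʳ _)
lowest-+ zero    (suc d) (plain ∷ t)  = lowest-+ zero d t
lowest-+ (suc h) d       (plain ∷ t)  = lowest-+ h d t

positive⇒flats≤ : ∀ h d t → Positive (suc (h + d)) t → flats h t ≤ d
positive⇒flats≤ h       d       []           _   = z≤n
positive⇒flats≤ zero    zero    (plain ∷ t)  ()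
positive⇒flats≤ zero    (suc d) (plain ∷ t)  pos = s≤s (positive⇒flats≤ zero d t pos)
positive⇒flats≤ (suc h) d       (plain ∷ t)  pos = positive⇒flats≤ h d t pos
positive⇒flats≤ h       d       (mark k ∷ t) pos =
  positive⇒flats≤ (h + k) d t (subst (λ h′ → Positive (suc h′) t) (+-right-comm h d k) pos)

flats≤⇒positive : ∀ h d t → flats h t ≤ d → Positive (suc (h + d)) t
flats≤⇒positive h       d       []           _         = tt
flats≤⇒positive zero    (suc d) (plain ∷ t)  (s≤s f≤d) = flats≤⇒positive zero d t f≤d
flats≤⇒positive (suc h) d       (plain ∷ t)  f≤d       = flats≤⇒positive h d t f≤d
flats≤⇒positive h       d       (mark k ∷ t) f≤d       =
  subst (λ h′ → Positive (suc h′) t) (+-right-comm h k d) (flats≤⇒positive (h + k) d t f≤d)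

firstReturn : ∀ k r → lowest (suc k) r ≡ 0 →
  Σ Word λ w → Σ Word λ y → (r ≡ w ++ plain ∷ y) × Positive (suc k) w × lowest (suc k) w ≡ 1
firstReturn zero    (plain ∷ r)  _ = [] , r , refl , tt , refl
firstReturn (suc k) (plain ∷ r)  e with firstReturn k r e
... | w , y , refl , pos , low = plain ∷ w , y , refl , pos , low
firstReturn k       (mark j ∷ r) e with firstReturn (k + j) r e
... | w , y , refl , pos , low = mark j ∷ w , y , refl , pos , low

splitAtReturn : ℕ → Word → Word × Word
splitAtReturn (suc k)       (mark j ∷ y) = map₁ (mark j ∷_) (splitAtReturn (suc k + j) y)
splitAtReturn (suc zero)    (plain ∷ y)  = [] , y
splitAtReturn (suc (suc k)) (plain ∷ y)  = map₁ (plain ∷_) (splitAtReturn (suc k) y)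
splitAtReturn _             _            = [] , []

splitAtReturn-++ : ∀ h w y → Positive h w → lowest h w ≡ 1 → splitAtReturn h (w ++ plain ∷ y) ≡ (w , y)
splitAtReturn-++ (suc zero)    []           y _   refl = refl
splitAtReturn-++ (suc (suc h)) (plain ∷ w)  y pos low =
  cong (map₁ (plain ∷_)) (splitAtReturn-++ (suc h) w y pos low)
splitAtReturn-++ (suc h)       (mark j ∷ w) y pos low =
  cong (map₁ (mark j ∷_)) (splitAtReturn-++ (suc h + j) w y pos low)

node : Word → Word → Word
node w y = mark (suc (flats 0 w)) ∷ w ++ plain ∷ y

unnode : Word → Word × Word
unnode (mark k ∷ r) = splitAtReturn k r
unnode _            = [] , []

weight-node : ∀ w y → weight (node w y) ≡ 3 + (weight w + weight y)
weight-node w y = cong (2 +_) (trans (weight-++ w (plain ∷ y)) (+-suc (weight w) (weight y)))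

node-returns : ∀ w → lowest 0 w ≡ 0 →
  Positive (suc (flats 0 w)) w × lowest (suc (flats 0 w)) w ≡ 1
node-returns w e =
  flats≤⇒positive 0 (flats 0 w) w ≤-refl ,
  trans (lowest-+ 0 (suc (flats 0 w)) w) (cong₂ _+_ e (m+n∸n≡m 1 (flats 0 w)))

unnode-node : ∀ w y → lowest 0 w ≡ 0 → unnode (node w y) ≡ (w , y)
unnode-node w y e = let pos , low = node-returns w e in
  splitAtReturn-++ (suc (flats 0 w)) w y pos low

lowest-node : ∀ w y → lowest 0 w ≡ 0 → lowest 0 y ≡ 0 → lowest 0 (node w y) ≡ 0
lowest-node w y ew ey = begin
  lowest (suc (flats 0 w)) (w ++ plain ∷ y)        ≡⟨ lowest-++ (suc (flats 0 w)) w (plain ∷ y) ⟩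
  lowest (lowest (suc (flats 0 w)) w) (plain ∷ y)
    ≡⟨ cong (λ h → lowest h (plain ∷ y)) (proj₂ (node-returns w ew)) ⟩
  lowest 0 y                                       ≡⟨ ey ⟩
  0                                                ∎
  where open ≡-Reasoning

mark≡node : ∀ k .{{_ : NonZero k}} r → lowest k r ≡ 0 →
  Σ Word λ w → Σ Word λ y → (mark k ∷ r ≡ node w y) × lowest 0 w ≡ 0 × lowest 0 y ≡ 0
mark≡node zero    r _ = contradiction refl (≢-nonZero⁻¹ 0)
mark≡node (suc k) r e with firstReturn k r e
... | w , y , refl , pos , low =
  w , y , cong (_∷ w ++ plain ∷ y) (mark-cong (cong suc k≡flats)) , proj₁ split , y-returns
  where
  open ≡-Reasoning
  flats≤k : flats 0 w ≤ k
  flats≤k = positive⇒flats≤ 0 k w pos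
  split : lowest 0 w ≡ 0 × k ∸ flats 0 w ≡ 0
  split = m+1+n≡1 _ _ (begin
    lowest 0 w + suc (k ∸ flats 0 w)  ≡⟨ cong (lowest 0 w +_) (sym (+-∸-assoc 1 flats≤k)) ⟩
    lowest 0 w + (suc k ∸ flats 0 w)  ≡⟨ sym (lowest-+ 0 (suc k) w) ⟩
    lowest (suc k) w                  ≡⟨ low ⟩
    1                                 ∎)
  k≡flats : k ≡ flats 0 w
  k≡flats = ≤-antisym (m∸n≡0⇒m≤n (proj₂ split)) flats≤k
  y-returns : lowest 0 y ≡ 0
  y-returns = begin
    lowest 0 y                                ≡⟨ cong (λ h → lowest h (plain ∷ y)) (sym low) ⟩
    lowest (lowest (suc k) w) (plain ∷ y)     ≡⟨ sym (lowest-++ (suc k) w (plain ∷ y)) ⟩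
    lowest (suc k) (w ++ plain ∷ y)           ≡⟨ e ⟩
    0                                         ∎

-- Enumerating the realizable words

Realizable : ℕ → Word → Set
Realizable n t = weight t ≡ n × lowest 0 t ≡ 0

pairs : (ℕ → List Word) → ℕ → List (Word × Word)
pairs T m = concatMap (λ i → cartesianProduct (T i) (T (m ∸ i))) (upTo (suc m))

nodes : (ℕ → List Word) → ℕ → List Word
nodes T (suc (suc m)) = map (uncurry node) (pairs T m)
nodes T _             = []

grow : (ℕ → List Word) → ℕ → List Word
grow T zero    = [] ∷ []
grow T (suc n) = map (plain ∷_) (T n) ++ nodes T n

-- Fuel: wordsWithin f n is the intended list only for n < f.
wordsWithin : ℕ → ℕ → List Word
wordsWithin zero    _ = []
wordsWithin (suc f) n = grow (wordsWithin f) n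

words : ℕ → List Word
words n = wordsWithin (suc n) n

count : ℕ → ℕ
count n = length (words n)

module _ (T : ℕ → List Word) where

  ∈-pairs⁻ : ∀ m {w y} → (w , y) ∈ pairs T m → Σ ℕ λ i → i ≤ m × w ∈ T i × y ∈ T (m ∸ i)
  ∈-pairs⁻ m wy∈ with find (∈-concatMap⁻ (λ i → cartesianProduct (T i) (T (m ∸ i))) wy∈)
  ... | i , i∈ , wy∈prod = i , s≤s⁻¹ (∈-upTo⁻ i∈) , ∈-cartesianProduct⁻ (T i) (T (m ∸ i)) wy∈prod

  ∈-pairs⁺ : ∀ {m i w y} → i ≤ m → w ∈ T i → y ∈ T (m ∸ i) → (w , y) ∈ pairs T m
  ∈-pairs⁺ i≤m w∈ y∈ = ∈-concatMap⁺ _ (lose (∈-upTo⁺ (s≤s i≤m)) (∈-cartesianProduct⁺ w∈ y∈))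

  module _ (sound : ∀ {i t} → t ∈ T i → Realizable i t) where

    pairs-sound : ∀ m {w y} → (w , y) ∈ pairs T m →
      weight w + weight y ≡ m × lowest 0 w ≡ 0 × lowest 0 y ≡ 0
    pairs-sound m wy∈ with ∈-pairs⁻ m wy∈
    ... | i , i≤m , w∈ , y∈ =
      let weight-w , lowest-w = sound w∈ ; weight-y , lowest-y = sound y∈ in
      trans (cong₂ _+_ weight-w weight-y) (m+[n∸m]≡n i≤m) , lowest-w , lowest-y

    nodes-sound : ∀ n {t} → t ∈ nodes T n → Realizable (suc n) t
    nodes-sound (suc (suc m)) t∈ with ∈-map⁻ (uncurry node) t∈
    ... | (w , y) , wy∈ , refl =
      let weight-wy , lowest-w , lowest-y = pairs-sound m wy∈ in
      trans (weight-node w y) (cong (3 +_) weight-wy) , lowest-node w y lowest-w lowest-y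

    grow-sound : ∀ n {t} → t ∈ grow T n → Realizable n t
    grow-sound zero    (here refl) = refl , refl
    grow-sound (suc n) t∈ with ∈-++⁻ (map (plain ∷_) (T n)) t∈
    ... | inj₂ t∈nodes = nodes-sound n t∈nodes
    ... | inj₁ t∈plains with ∈-map⁻ (plain ∷_) t∈plains
    ...   | t , t∈ , refl = cong suc (proj₁ (sound t∈)) , proj₂ (sound t∈)

    module _ (unique : ∀ i → Unique (T i)) where

      pairs-unique : ∀ m → Unique (pairs T m)
      pairs-unique m = Unique-concatMap⁺ (weight ∘ proj₁) first-weight
        (λ i → Unique.cartesianProduct⁺ (unique i) (unique (m ∸ i))) (Unique.upTo⁺ (suc m))
        where
        first-weight : ∀ {i wy} → wy ∈ cartesianProduct (T i) (T (m ∸ i)) → weight (proj₁ wy) ≡ i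
        first-weight {i} wy∈ = proj₁ (sound (proj₁ (∈-cartesianProduct⁻ (T i) (T (m ∸ i)) wy∈)))

      nodes-unique : ∀ n → Unique (nodes T n)
      nodes-unique (suc (suc m)) = unique-map⁺ node-injective
        (All.tabulate (λ wy∈ → proj₁ (proj₂ (pairs-sound m wy∈)))) (pairs-unique m)
        where
        node-injective : ∀ {(w , y) (w′ , y′) : Word × Word} → lowest 0 w ≡ 0 → lowest 0 w′ ≡ 0 →
          node w y ≡ node w′ y′ → (w , y) ≡ (w′ , y′)
        node-injective {w , y} {w′ , y′} lw lw′ eq =
          trans (sym (unnode-node w y lw)) (trans (cong unnode eq) (unnode-node w′ y′ lw′))
      nodes-unique zero          = []
      nodes-unique (suc zero)    = []

      grow-unique : ∀ n → Unique (grow T n)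
      grow-unique zero    = [] ∷ []
      grow-unique (suc n) =
        Unique.++⁺ (Unique.map⁺ ∷-injectiveʳ (unique n)) (nodes-unique n) (plain≢node n)
        where
        plain≢node : ∀ n → Disjoint (map (plain ∷_) (T n)) (nodes T n)
        plain≢node (suc (suc m)) (t∈plains , t∈nodes)
          with ∈-map⁻ (plain ∷_) t∈plains | ∈-map⁻ (uncurry node) t∈nodes
        ... | _ , _ , refl | _ , _ , ()

  ContainsLighter : Word → Set
  ContainsLighter t = ∀ {s} → weight s < weight t → lowest 0 s ≡ 0 → s ∈ T (weight s)

  node∈grow : ∀ w y → lowest 0 w ≡ 0 → lowest 0 y ≡ 0 →
    ContainsLighter (node w y) → node w y ∈ grow T (weight (node w y))
  node∈grow w y lw ly complete = subst (λ n → node w y ∈ grow T n) (sym (weight-node w y))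
    (∈-++⁺ʳ _ (∈-map⁺ (uncurry node) (∈-pairs⁺ (m≤m+n (weight w) (weight y)) w∈ y∈)))
    where
    lighter : ∀ {s} → weight s ≤ weight w + weight y → weight s < weight (node w y)
    lighter {s} s≤ =
      subst (weight s <_) (sym (weight-node w y)) (s≤s (≤-trans s≤ (m≤n+m (weight w + weight y) 2)))
    w∈ : w ∈ T (weight w)
    w∈ = complete {w} (lighter {w} (m≤m+n (weight w) (weight y))) lw
    y∈ : y ∈ T (weight w + weight y ∸ weight w)
    y∈ = subst (λ i → y ∈ T i) (sym (m+n∸m≡n (weight w) (weight y)))
      (complete {y} (lighter {y} (m≤n+m (weight y) (weight w))) ly)

  grow-complete : ∀ t → ContainsLighter t → lowest 0 t ≡ 0 → t ∈ grow T (weight t)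
  grow-complete []           _        _ = here refl
  grow-complete (plain ∷ t)  complete l = ∈-++⁺ˡ (∈-map⁺ (plain ∷_) (complete ≤-refl l))
  grow-complete (mark k ∷ r) complete l with mark≡node k r l
  ... | w , y , eq , lw , ly =
    subst (λ t → ContainsLighter t → t ∈ grow T (weight t)) (sym eq) (node∈grow w y lw ly) complete

wordsWithin-sound : ∀ f {n t} → t ∈ wordsWithin f n → Realizable n t
wordsWithin-sound (suc f) {n} = grow-sound (wordsWithin f) (wordsWithin-sound f) n

wordsWithin-unique : ∀ f n → Unique (wordsWithin f n)
wordsWithin-unique zero    _ = []
wordsWithin-unique (suc f)   = grow-unique (wordsWithin f) (wordsWithin-sound f) (wordsWithin-unique f)

wordsWithin-complete : ∀ f t → weight t < f → lowest 0 t ≡ 0 → t ∈ wordsWithin f (weight t)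
wordsWithin-complete (suc f) t t<f = grow-complete (wordsWithin f) t
  (λ s<t → wordsWithin-complete f _ (<-≤-trans s<t (s≤s⁻¹ t<f)))

words-sound : ∀ {n t} → t ∈ words n → Realizable n t
words-sound {n} = wordsWithin-sound (suc n)

words-unique : ∀ n → Unique (words n)
words-unique n = wordsWithin-unique (suc n) n

words-complete : ∀ {n t} → Realizable n t → t ∈ words n
words-complete {t = t} (refl , l) = wordsWithin-complete (suc (weight t)) t ≤-refl l

pairs-cong : ∀ {T T′} m → (∀ {i} → i ≤ m → T i ≡ T′ i) → pairs T m ≡ pairs T′ m
pairs-cong m T≡T′ = cong concat (map-cong-local (All.tabulate (λ {i} i∈ →
  cong₂ cartesianProduct (T≡T′ (s≤s⁻¹ (∈-upTo⁻ i∈))) (T≡T′ (m∸n≤m m i)))))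

nodes-cong : ∀ {T T′} n → (∀ {i} → i < suc n → T i ≡ T′ i) → nodes T n ≡ nodes T′ n
nodes-cong zero          _    = refl
nodes-cong (suc zero)    _    = refl
nodes-cong (suc (suc m)) T≡T′ =
  cong (map (uncurry node)) (pairs-cong m (λ i≤m → T≡T′ (s≤s (≤-trans i≤m (m≤n+m m 2)))))

grow-cong : ∀ {T T′} n → (∀ {i} → i < n → T i ≡ T′ i) → grow T n ≡ grow T′ n
grow-cong zero    _    = refl
grow-cong (suc n) T≡T′ = cong₂ _++_ (cong (map (plain ∷_)) (T≡T′ ≤-refl)) (nodes-cong n T≡T′)

wordsWithin-fuel : ∀ {f g n} → n < f → n < g → wordsWithin f n ≡ wordsWithin g n
wordsWithin-fuel {suc f} {suc g} {n} n<f n<g = grow-cong n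
  (λ i<n → wordsWithin-fuel (<-≤-trans i<n (s≤s⁻¹ n<f)) (<-≤-trans i<n (s≤s⁻¹ n<g)))

words-unfold : ∀ n → words n ≡ grow words n
words-unfold n = grow-cong n (λ {i} i<n → wordsWithin-fuel i<n (n<1+n i))

length-pairs : ∀ T m →
  length (pairs T m) ≡ sum (map (λ i → length (T i) * length (T (m ∸ i))) (upTo (suc m)))
length-pairs T m =
  trans (length-concatMap (λ i → cartesianProduct (T i) (T (m ∸ i))) (upTo (suc m)))
  (cong sum (map-cong (λ i → length-cartesianProduct (T i) (T (m ∸ i))) (upTo (suc m))))

count-rec : ∀ n → count (3 + n) ≡ count (2 + n) + conv count n
count-rec n = begin
  length (words (3 + n))                  ≡⟨ cong length (words-unfold (3 + n)) ⟩
  length (plains ++ nodes words (2 + n))  ≡⟨ length-++ plains ⟩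
  length plains + length (nodes words (2 + n))
    ≡⟨ cong₂ _+_ (length-map _ (words (2 + n)))
                 (trans (length-map _ (pairs words n)) (length-pairs words n)) ⟩
  count (2 + n) + conv count n            ∎
  where
  open ≡-Reasoning
  plains = map (plain ∷_) (words (2 + n))

count-hasGF : HasGF count
count-hasGF = refl , refl , refl , count-rec

-- Occurrences of a two-step pattern

ValidFrom-F : ∀ {h p} → ValidFrom h (F ∷ p) ⇔ ValidFrom h p
ValidFrom-F {zero}  = ⇔-refl
ValidFrom-F {suc h} = ⇔-refl

ValidFrom-U : ∀ {h k} .{{_ : NonZero k}} {p} → ValidFrom h (U k ∷ p) ⇔ ValidFrom (h + k) p
ValidFrom-U {zero}  = ⇔-refl
ValidFrom-U {suc h} = ⇔-refl

lowest-plain : ∀ {h t} → (∀ {g} → g ≤ h → lowest g t ≡ 0) →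
  ∀ {g} → g ≤ suc h → lowest g (plain ∷ t) ≡ 0
lowest-plain low {zero}  _   = low z≤n
lowest-plain low {suc g} g≤h = low (s≤s⁻¹ g≤h)

-- first≢D and FF-not-occurrence say that the D and F steps of a lowest realization never start
-- an occurrence.
record Pattern : Set where
  field
    first second : (k : ℕ) → .{{NonZero k}} → Step
    injective : ∀ {k j} .{{_ : NonZero k}} .{{_ : NonZero j}} →
      first k ≡ first j → second k ≡ second j → k ≡ j
    non-overlapping : ∀ {k j} .{{_ : NonZero k}} .{{_ : NonZero j}} → second k ≢ first j
    first≢D : ∀ {k} .{{_ : NonZero k}} → first k ≢ D
    FF-not-occurrence : ∀ {k} .{{_ : NonZero k}} → first k ≡ F → second k ≢ F
    valid-occurrence : ∀ {h k} .{{_ : NonZero k}} {s} →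
      ValidFrom h (first k ∷ second k ∷ s) ⇔ ValidFrom (h + k) s

module Occurrences (P : Pattern) where
  open Pattern P

  -- For the patterns FU and UF below, Occ and _≈_ unfold to OccFU, FU-equiv and OccUF, UF-equiv.
  Occ : (k : ℕ) → .{{NonZero k}} → Path → ℕ → Set
  Occ k p i = (stepAt p i ≡ just (first k)) × (stepAt p (suc i) ≡ just (second k))

  _≈_ : Path → Path → Set
  p ≈ q = (k : ℕ) → .{{_ : NonZero k}} → (i : ℕ) → Occ k p i ⇔ Occ k q i

  NoOccAtHead : Path → Set
  NoOccAtHead p = ∀ k .{{_ : NonZero k}} → ¬ Occ k p 1

  ≈-refl : ∀ {p} → p ≈ p
  ≈-refl k i = ⇔-refl

  ∷-≈ : ∀ {x y p q} → (∀ k .{{_ : NonZero k}} → Occ k (x ∷ p) 1 ⇔ Occ k (y ∷ q) 1) → p ≈ q →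
    (x ∷ p) ≈ (y ∷ q)
  ∷-≈ head tail k zero          = mk⇔ (λ { (() , _) }) (λ { (() , _) })
  ∷-≈ head tail k (suc zero)    = head k
  ∷-≈ head tail k (suc (suc i)) = tail k (suc i)

  ≈-tail : ∀ {x y p q} → (x ∷ p) ≈ (y ∷ q) → p ≈ q
  ≈-tail {p = p} {q} x∷p≈y∷q k zero = mk⇔ (⊥-elim ∘ noOcc p) (⊥-elim ∘ noOcc q)
    where noOcc : ∀ p → ¬ Occ k p 0
          noOcc []      (() , _)
          noOcc (_ ∷ _) (() , _)
  ≈-tail x∷p≈y∷q k (suc i) = x∷p≈y∷q k (suc (suc i))

  occ-≈ : ∀ {k} .{{_ : NonZero k}} {p q} → p ≈ q → (first k ∷ second k ∷ p) ≈ (first k ∷ second k ∷ q)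
  occ-≈ {k} {p} {q} p≈q =
    ∷-≈ (λ _ → ⇔-refl) (∷-≈ (λ j → mk⇔ (⊥-elim ∘ overlapping j p) (⊥-elim ∘ overlapping j q)) p≈q)
    where overlapping : ∀ j .{{_ : NonZero j}} s → ¬ Occ j (second k ∷ s) 1
          overlapping j s (eq , _) = non-overlapping (just-injective eq)

  data Parse : Path → Set where
    []    : Parse []
    occ   : ∀ k .{{_ : NonZero k}} {p} → Parse p → Parse (first k ∷ second k ∷ p)
    other : ∀ {x p} → NoOccAtHead (x ∷ p) → Parse p → Parse (x ∷ p)

  marks : ∀ {p} → Parse p → Word
  marks []          = []
  marks (occ k π)   = mark k ∷ marks π
  marks (other _ π) = plain ∷ marks π

  weight-marks : ∀ {p} (π : Parse p) → weight (marks π) ≡ length p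
  weight-marks []          = refl
  weight-marks (occ k π)   = cong (2 +_) (weight-marks π)
  weight-marks (other _ π) = cong suc (weight-marks π)

  marks⇒≈ : ∀ {p q} (π : Parse p) (ρ : Parse q) → marks π ≡ marks ρ → p ≈ q
  marks⇒≈ []                  []            _  = ≈-refl {[]}
  -- Two NonZero k instances are in scope here; naming one avoids an ambiguous instance search.
  marks⇒≈ (occ k ⦃ k≢0 ⦄ π)   (occ j ρ)     eq with mark-injective (∷-injectiveˡ eq)
  ... | refl = occ-≈ ⦃ k≢0 ⦄ (marks⇒≈ π ρ (∷-injectiveʳ eq))
  marks⇒≈ (other nh π)        (other nh′ ρ) eq =
    ∷-≈ (λ k → mk⇔ (⊥-elim ∘ nh k) (⊥-elim ∘ nh′ k)) (marks⇒≈ π ρ (∷-injectiveʳ eq))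

  ≈⇒marks : ∀ {p q} (π : Parse p) (ρ : Parse q) → p ≈ q → length p ≡ length q → marks π ≡ marks ρ
  ≈⇒marks []           []            _   _ = refl
  ≈⇒marks (occ k π)    (occ j ρ)     p≈q l =
    let first≡ , second≡ = Equivalence.to (p≈q k 1) (refl , refl) in
    cong₂ _∷_ (mark-cong (sym (injective (just-injective first≡) (just-injective second≡))))
      (≈⇒marks π ρ (≈-tail (≈-tail p≈q)) (suc-injective (suc-injective l)))
  ≈⇒marks (occ k π)    (other nh ρ)  p≈q _ = ⊥-elim (nh k (Equivalence.to (p≈q k 1) (refl , refl)))
  ≈⇒marks (other nh π) (occ k ρ)     p≈q _ = ⊥-elim (nh k (Equivalence.from (p≈q k 1) (refl , refl)))
  ≈⇒marks (other _ π)  (other _ ρ)   p≈q l = cong (plain ∷_) (≈⇒marks π ρ (≈-tail p≈q) (suc-injective l))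

  lowest-marks : ∀ {h p} → ValidFrom h p → (π : Parse p) → ∀ {g} → g ≤ h → lowest g (marks π) ≡ 0
  lowest-marks refl []  g≤0 = n≤0⇒n≡0 g≤0
  lowest-marks {h} v (occ k {p} π) g≤h =
    lowest-marks (Equivalence.to (valid-occurrence {h} {k} {p}) v) π (+-monoˡ-≤ k g≤h)
  lowest-marks {suc h} {D ∷ p} v (other _ π) g≤h = lowest-plain (lowest-marks v π) g≤h
  lowest-marks {h} {F ∷ p} v (other _ π) g≤h =
    lowest-plain (lowest-marks (Equivalence.to (ValidFrom-F {h} {p}) v) π) (m≤n⇒m≤1+n g≤h)
  lowest-marks {h} {U k ∷ p} v (other _ π) g≤h =
    lowest-plain (lowest-marks (Equivalence.to (ValidFrom-U {h} {k} {p}) v) π)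
      (m≤n⇒m≤1+n (≤-trans g≤h (m≤m+n h k)))

  realize : ℕ → Word → Path
  realize h       []           = []
  realize h       (mark k ∷ t) = first k ∷ second k ∷ realize (h + k) t
  realize zero    (plain ∷ t)  = F ∷ realize zero t
  realize (suc h) (plain ∷ t)  = D ∷ realize h t

  length-realize : ∀ h t → length (realize h t) ≡ weight t
  length-realize h       []           = refl
  length-realize h       (mark k ∷ t) = cong (2 +_) (length-realize (h + k) t)
  length-realize zero    (plain ∷ t)  = cong suc (length-realize zero t)
  length-realize (suc h) (plain ∷ t)  = cong suc (length-realize h t)

  realize-valid : ∀ h t → lowest h t ≡ 0 → ValidFrom h (realize h t)
  realize-valid h       []           low = low
  realize-valid h       (mark k ∷ t) low =
    Equivalence.from (valid-occurrence {h} {k} {realize (h + k) t}) (realize-valid (h + k) t low)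
  realize-valid zero    (plain ∷ t)  low = realize-valid zero t low
  realize-valid (suc h) (plain ∷ t)  low = realize-valid h t low

  F∷realize-noOcc : ∀ t → NoOccAtHead (F ∷ realize zero t)
  F∷realize-noOcc []           k (_ , ())
  F∷realize-noOcc (plain ∷ t)  k (F≡first , F≡second) =
    FF-not-occurrence (sym (just-injective F≡first)) (sym (just-injective F≡second))
  F∷realize-noOcc (mark j ∷ t) k (_ , first≡second) = non-overlapping (sym (just-injective first≡second))

  parse-realize : ∀ h t → Parse (realize h t)
  parse-realize h       []           = []
  parse-realize h       (mark k ∷ t) = occ k (parse-realize (h + k) t)
  parse-realize zero    (plain ∷ t)  = other (F∷realize-noOcc t) (parse-realize zero t)
  parse-realize (suc h) (plain ∷ t)  =
    other (λ k (D≡first , _) → first≢D (sym (just-injective D≡first))) (parse-realize h t)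

  marks-parse-realize : ∀ h t → marks (parse-realize h t) ≡ t
  marks-parse-realize h       []           = refl
  marks-parse-realize h       (mark k ∷ t) = cong (mark k ∷_) (marks-parse-realize (h + k) t)
  marks-parse-realize zero    (plain ∷ t)  = cong (plain ∷_) (marks-parse-realize zero t)
  marks-parse-realize (suc h) (plain ∷ t)  = cong (plain ∷_) (marks-parse-realize h t)

  numClasses : (∀ p → Parse p) → ∀ n → NumClasses _≈_ n (count n)
  numClasses parse n =
    map (realize 0) (words n) ,
    length-map (realize 0) (words n) ,
    All.map⁺ (All.tabulate λ {t} t∈ → let weight-t , lowest-t = words-sound t∈ in
      trans (length-realize 0 t) weight-t , realize-valid 0 t lowest-t) ,
    unique-map⁺ realize-injective (All.tabulate words-sound) (words-unique n) ,
    covered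
    where
    realize-injective : ∀ {t t′} → Realizable n t → Realizable n t′ → realize 0 t ≈ realize 0 t′ → t ≡ t′
    realize-injective {t} {t′} (weight-t , _) (weight-t′ , _) t≈t′ = begin
      t                                ≡⟨ sym (marks-parse-realize 0 t) ⟩
      marks (parse-realize 0 t)
        ≡⟨ ≈⇒marks (parse-realize 0 t) (parse-realize 0 t′) t≈t′ same-length ⟩
      marks (parse-realize 0 t′)       ≡⟨ marks-parse-realize 0 t′ ⟩
      t′                               ∎
      where
      open ≡-Reasoning
      same-length : length (realize 0 t) ≡ length (realize 0 t′)
      same-length =
        trans (length-realize 0 t) (trans weight-t (sym (trans (length-realize 0 t′) weight-t′)))

    covered : ∀ p → Luk n p → Any (p ≈_) (map (realize 0) (words n))
    covered p (length-p , valid-p) = Any.map⁺ (Any.map p≈realize marks∈words)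
      where
      marks∈words : marks (parse p) ∈ words n
      marks∈words = words-complete
        (trans (weight-marks (parse p)) length-p , lowest-marks valid-p (parse p) z≤n)
      p≈realize : ∀ {t} → marks (parse p) ≡ t → p ≈ realize 0 t
      p≈realize {t} eq = marks⇒≈ (parse p) (parse-realize 0 t) (trans eq (sym (marks-parse-realize 0 t)))

FU : Pattern
FU = record
  { first             = λ _ → F
  ; second            = λ k → U k
  ; injective         = λ { _ refl → refl }
  ; non-overlapping   = λ ()
  ; first≢D           = λ ()
  ; FF-not-occurrence = λ _ ()
  ; valid-occurrence  = λ {h} {k} {s} → ⇔-trans (ValidFrom-F {h}) (ValidFrom-U {h} {k} {s})
  }

UF : Pattern
UF = record
  { first             = λ k → U k
  ; second            = λ _ → F
  ; injective         = λ { refl _ → refl }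
  ; non-overlapping   = λ ()
  ; first≢D           = λ ()
  ; FF-not-occurrence = λ ()
  ; valid-occurrence  = λ {h} {k} {s} → ⇔-trans (ValidFrom-U {h} {k}) (ValidFrom-F {h + k} {s})
  }

module _ where
  open Occurrences FU

  parse-FU : ∀ p → Parse p
  parse-FU []            = []
  parse-FU (D ∷ p)       = other (λ _ → λ { (() , _) }) (parse-FU p)
  parse-FU (U _ ∷ p)     = other (λ _ → λ { (() , _) }) (parse-FU p)
  parse-FU (F ∷ [])      = other (λ _ → λ { (_ , ()) }) []
  parse-FU (F ∷ D ∷ p)   = other (λ _ → λ { (_ , ()) }) (parse-FU (D ∷ p))
  parse-FU (F ∷ F ∷ p)   = other (λ _ → λ { (_ , ()) }) (parse-FU (F ∷ p))
  parse-FU (F ∷ U k ∷ p) = occ k (parse-FU p)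

module _ where
  open Occurrences UF

  parse-UF : ∀ p → Parse p
  parse-UF []              = []
  parse-UF (D ∷ p)         = other (λ _ → λ { (() , _) }) (parse-UF p)
  parse-UF (F ∷ p)         = other (λ _ → λ { (() , _) }) (parse-UF p)
  parse-UF (U _ ∷ [])      = other (λ _ → λ { (_ , ()) }) []
  parse-UF (U _ ∷ D ∷ p)   = other (λ _ → λ { (_ , ()) }) (parse-UF (D ∷ p))
  parse-UF (U _ ∷ U j ∷ p) = other (λ _ → λ { (_ , ()) }) (parse-UF (U j ∷ p))
  parse-UF (U k ∷ F ∷ p)   = occ k (parse-UF p)

theorem12 : Σ (ℕ → ℕ) λ c →
    ((n : ℕ) → NumClasses FU-equiv n (c n)) ×
    ((n : ℕ) → NumClasses UF-equiv n (c n)) ×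
    HasGF c
theorem12 = count , Occurrences.numClasses FU parse-FU , Occurrences.numClasses UF parse-UF , count-hasGF
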